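{- In the core model structure on $\mathcal{G}$, any two morphisms $f,g:G\to H$ with the same domain and the same codomain are homotopic.
   Context: A graph is a finite set of vertices with a symmetric binary relation (loops allowed, no multiple edges); homomorphisms are vertex maps sending edges to edges. $\mathcal{G}$ is the category with one representative of each isomorphism class of finite graphs and homomorphisms as morphisms; coproduct is disjoint union. A retraction is a morphism $r:A\to B$ with some $s:B\to A$ such that $r\circ s=1_B$. The core $G_{core}$ of $G$ is a retract of $G$ with fewest vertices (unique up to isomorphism). A homomorphism $f:G\to H$ induces an isomorphism on cores if $r_H\circ f\circ s_G:G_{core}\to H_{core}$ is an isomorphism, where $s_G$ is a section $G_{core}\to G$ and $r_H$ a retraction $H\to H_{core}$. A morphism $f$ lifts on the left of $g$ if every commutative square with $f$ on the left and $g$ on the right has a diagonal filler. The core model structure on $\mathcal{G}$ has as weak equivalences the homomorphisms inducing isomorphisms on cores, as cofibrations the canonical injections into a coproduct (morphisms isomorphic under the codomain to an inclusion $A\to A+B$), and as fibrations the morphisms lifting on the right of all cofibrations that are weak equivalences. Homotopy in a model category: a cylinder object for $A$ is a factorization $A+A\xrightarrow{(i_0,i_1)} A'\xrightarrow{p} A$ of the fold map $(1_A,1_A)$ with $(i_0,i_1)$ a cofibration and $p$ a weak equivalence; $f,g:A\to X$ are (left) homotopic if there is a cylinder object and a morphism $K:A'\to X$ with $K\circ i_0=f$ and $K\circ i_1=g$. (Right homotopy is defined dually with path objects; when all objects are fibrant and cofibrant, left and right homotopy coincide.) -}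

module Defs where

open import Data.Nat using (ℕ; _≤_; _+_)
open import Data.Fin using (Fin; _↑ˡ_; _↑ʳ_; splitAt)
open import Data.Fin.Properties using (splitAt-↑ˡ; splitAt-↑ʳ)
open import Data.Bool using (Bool; true; false)
open import Data.Sum using (_⊎_; inj₁; inj₂; [_,_])
open import Data.Product using (Σ; _×_; _,_)
open import Relation.Binary.PropositionalEquality using (_≡_; refl)

-- A finite graph: vertex set Fin size, symmetric edge relation (loops allowed,
-- no multiple edges), given as a Bool-valued adjacency function.
record Graph : Set where
  field
    size     : ℕ
    edge     : Fin size → Fin size → Bool
    edge-sym : ∀ x y → edge x y ≡ edge y x
open Graph public

record Hom (G H : Graph) : Set where
  constructor hom
  field
    fun  : Fin (size G) → Fin (size H)
    pres : ∀ x y → edge G x y ≡ true → edge H (fun x) (fun y) ≡ true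
open Hom public

idH : {G : Graph} → Hom G G
idH = hom (λ x → x) (λ x y e → e)

_∘H_ : {A B C : Graph} → Hom B C → Hom A B → Hom A C
g ∘H f = hom (λ x → fun g (fun f x)) (λ x y e → pres g _ _ (pres f x y e))

_≈H_ : {A B : Graph} → Hom A B → Hom A B → Set
f ≈H g = ∀ x → fun f x ≡ fun g x

IsIso : {A B : Graph} → Hom A B → Set
IsIso {A} {B} f = Σ (Hom B A) λ g → ((g ∘H f) ≈H idH) × ((f ∘H g) ≈H idH)

IsRetraction : {A B : Graph} → Hom A B → Set
IsRetraction {A} {B} r = Σ (Hom B A) λ s → (r ∘H s) ≈H idH

IsSection : {B A : Graph} → Hom B A → Set
IsSection {B} {A} s = Σ (Hom A B) λ r → (r ∘H s) ≈H idH

IsRetractOf : Graph → Graph → Set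
IsRetractOf B A = Σ (Hom A B) IsRetraction

IsCoreOf : Graph → Graph → Set
IsCoreOf C G = IsRetractOf C G × (∀ (R : Graph) → IsRetractOf R G → size C ≤ size R)

-- f : G → H induces an isomorphism on cores: r_H ∘ f ∘ s_G is an isomorphism
-- for a section s_G : G_core → G and a retraction r_H : H → H_core.
IsWeakEquivalence : {G H : Graph} → Hom G H → Set
IsWeakEquivalence {G} {H} f =
  Σ Graph λ C → Σ Graph λ D → IsCoreOf C G × IsCoreOf D H ×
  Σ (Hom C G) λ s → IsSection s × Σ (Hom H D) λ r → IsRetraction r ×
  IsIso (r ∘H (f ∘H s))

sumEdge : {a b : ℕ} → (Fin a → Fin a → Bool) → (Fin b → Fin b → Bool) →
          Fin a ⊎ Fin b → Fin a ⊎ Fin b → Bool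
sumEdge E F (inj₁ x) (inj₁ y) = E x y
sumEdge E F (inj₂ x) (inj₂ y) = F x y
sumEdge E F (inj₁ x) (inj₂ y) = false
sumEdge E F (inj₂ x) (inj₁ y) = false

sumEdge-sym : {a b : ℕ} (E : Fin a → Fin a → Bool) (F : Fin b → Fin b → Bool) →
              (∀ x y → E x y ≡ E y x) → (∀ x y → F x y ≡ F y x) →
              ∀ u v → sumEdge E F u v ≡ sumEdge E F v u
sumEdge-sym E F sE sF (inj₁ x) (inj₁ y) = sE x y
sumEdge-sym E F sE sF (inj₂ x) (inj₂ y) = sF x y
sumEdge-sym E F sE sF (inj₁ x) (inj₂ y) = refl
sumEdge-sym E F sE sF (inj₂ x) (inj₁ y) = refl

_⊕_ : Graph → Graph → Graph
G ⊕ H = record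
  { size = size G + size H
  ; edge = λ x y → sumEdge (edge G) (edge H) (splitAt (size G) x) (splitAt (size G) y)
  ; edge-sym = λ x y → sumEdge-sym (edge G) (edge H) (edge-sym G) (edge-sym H)
                          (splitAt (size G) x) (splitAt (size G) y)
  }

inl : {A B : Graph} → Hom A (A ⊕ B)
inl {A} {B} = hom (λ x → x ↑ˡ size B) pr
  where
  pr : ∀ x y → edge A x y ≡ true → edge (A ⊕ B) (x ↑ˡ size B) (y ↑ˡ size B) ≡ true
  pr x y e rewrite splitAt-↑ˡ (size A) x (size B) | splitAt-↑ˡ (size A) y (size B) = e

copair : {A B C : Graph} → Hom A C → Hom B C → Hom (A ⊕ B) C
copair {A} {B} {C} f g =
  hom (λ x → [ fun f , fun g ] (splitAt (size A) x))
      (λ x y e → pr (splitAt (size A) x) (splitAt (size A) y) e)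
  where
  pr : ∀ u v → sumEdge (edge A) (edge B) u v ≡ true →
       edge C ([ fun f , fun g ] u) ([ fun f , fun g ] v) ≡ true
  pr (inj₁ x) (inj₁ y) e = pres f x y e
  pr (inj₂ x) (inj₂ y) e = pres g x y e
  pr (inj₁ x) (inj₂ y) ()
  pr (inj₂ x) (inj₁ y) ()

IsCofibration : {X Y : Graph} → Hom X Y → Set
IsCofibration {X} {Y} c =
  Σ Graph λ B → Σ (Hom (X ⊕ B) Y) λ φ → IsIso φ × ((φ ∘H inl) ≈H c)

record Cylinder (A : Graph) : Set where
  field
    obj   : Graph
    i₀ i₁ : Hom A obj
    p     : Hom obj A
    cof   : IsCofibration (copair i₀ i₁)
    weq   : IsWeakEquivalence p
    fact  : (p ∘H copair i₀ i₁) ≈H copair idH idH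
open Cylinder public

LeftHomotopic : {A X : Graph} → Hom A X → Hom A X → Set
LeftHomotopic {A} {X} f g =
  Σ (Cylinder A) λ Cyl → Σ (Hom (obj Cyl) X) λ K →
    ((K ∘H i₀ Cyl) ≈H f) × ((K ∘H i₁ Cyl) ≈H g)

module Submission where

-- Any two homomorphisms f, g : G → H are left homotopic in the core model
-- structure, through the cylinder  G + G --(inl, inr)--> G + G --fold--> G.
-- Then (inl, inr) is the identity of G + G, hence a cofibration, and the
-- homotopy is simply copair f g.  The real content is that fold is a weak
-- equivalence, which requires cores to exist.
--
-- Existence of cores is proved constructively.  Call an endomorphism of A of
-- the form A → Fin k → A a factorisation through k; whether one exists is
-- decidable by finite search, so there is a least such k.  For a least one the
-- loop Fin k → A → Fin k is injective (otherwise it could be compressed through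
-- k - 1), hence has finite order dividing k!, and a suitable power of it yields
-- a retraction of A onto an induced subgraph on k vertices.  Any retract R of
-- A gives a factorisation through size R, so this retract is a core.  Finally,
-- a core of A is a core of any graph B of which A is a retract; applied to
-- fold : G + G → G with section inl this shows that fold is a weak
-- equivalence.

open import Defs
open import Data.Nat using (ℕ; zero; suc; _+_; _*_; _∸_; _≤_; _<_; _!)
open import Data.Nat.Properties
  using (≤-trans; ≤-pred; <⇒≤; ≮⇒≥; n<1+n; 1+n≰n; 1≤n!; m∸n≤m; m<n⇒0<n∸m; m∸n+n≡m; m+[n∸m]≡n; anyUpTo?)
open import Data.Nat.Divisibility using (divides; ∣-trans; m∣m*n; m≤n⇒m!∣n!)
open import Data.Nat.Induction using (<-rec)
open import Data.Fin using (Fin; zero; suc; toℕ; punchIn; punchOut; _↑ʳ_; splitAt; join)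
  renaming (_≟_ to _≟F_)
open import Data.Fin.Properties
  using (any?; all?; pigeonhole; punchIn-punchOut; splitAt-↑ˡ; splitAt-↑ʳ; join-splitAt; toℕ<n)
open import Data.Vec.Functional using (_∷_; head; tail)
open import Data.Bool using (true)
open import Data.Bool.Properties using () renaming (_≟_ to _≟B_)
open import Data.Sum using (_⊎_; inj₁; inj₂; [_,_])
open import Data.Product using (Σ; ∃; _×_; _,_; proj₁; proj₂)
open import Data.Empty using (⊥-elim)
open import Function using (_∘_)
open import Function.Definitions using (Injective)
open import Relation.Nullary using (Dec; yes; no; ¬?)
open import Relation.Nullary.Decidable using (map′; _→-dec_; _×-dec_)
open import Relation.Binary.PropositionalEquality
  using (_≡_; _≢_; refl; sym; trans; cong; subst; subst₂; module ≡-Reasoning)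

functionSearch : ∀ a b (P : (Fin a → Fin b) → Set) →
                 (∀ {f g} → (∀ x → f x ≡ g x) → P f → P g) →
                 (∀ f → Dec (P f)) → Dec (∃ P)
functionSearch zero b P resp P? = map′ (λ p → (λ ()) , p) fromEmpty (P? (λ ()))
  where
  fromEmpty : ∃ P → P (λ ())
  fromEmpty (f , p) = resp (λ ()) p
functionSearch (suc a) b P resp P? =
  map′ (λ (y , f , p) → y ∷ f , p) split
       (any? λ y → functionSearch a b (P ∘ (y ∷_))
                     (λ eq → resp λ { zero → refl ; (suc i) → eq i })
                     (P? ∘ (y ∷_)))
  where
  η : (f : Fin (suc a) → Fin b) → ∀ x → f x ≡ (head f ∷ tail f) x
  η f zero    = refl
  η f (suc i) = refl
  split : ∃ P → Σ (Fin b) λ y → ∃ (P ∘ (y ∷_))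
  split (f , p) = head f , tail f , resp (η f) p

leastWitness : {Q : ℕ → Set} → (∀ k → Dec (Q k)) → ∀ m → Q m →
               Σ ℕ λ k → Q k × (∀ j → Q j → k ≤ j)
leastWitness {Q} Q? = <-rec (λ m → Q m → Least) step
  where
  Least : Set
  Least = Σ ℕ λ k → Q k × (∀ j → Q j → k ≤ j)
  step : ∀ m → (∀ {n} → n < m → Q n → Least) → Q m → Least
  step m smaller qm with anyUpTo? Q? m
  ... | yes (n , n<m , qn) = smaller n<m qn
  ... | no none            = m , qm , λ j qj → ≮⇒≥ λ j<m → none (j , j<m , qj)

iter : ∀ {n} → ℕ → (Fin n → Fin n) → Fin n → Fin n
iter zero    t x = x
iter (suc j) t x = t (iter j t x)

iter-+ : ∀ {n} a b t (x : Fin n) → iter (a + b) t x ≡ iter a t (iter b t x)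
iter-+ zero    b t x = refl
iter-+ (suc a) b t x = cong t (iter-+ a b t x)

iter-injective : ∀ {n} j {t : Fin n → Fin n} → Injective _≡_ _≡_ t → Injective _≡_ _≡_ (iter j t)
iter-injective zero    inj eq = eq
iter-injective (suc j) inj eq = iter-injective j inj (inj eq)

iter-multiple : ∀ {n} c p t (x : Fin n) → iter p t x ≡ x → iter (c * p) t x ≡ x
iter-multiple zero    p t x eq = refl
iter-multiple (suc c) p t x eq = begin
  iter (p + c * p) t x         ≡⟨ iter-+ p (c * p) t x ⟩
  iter p t (iter (c * p) t x)  ≡⟨ cong (iter p t) (iter-multiple c p t x eq) ⟩
  iter p t x                   ≡⟨ eq ⟩
  x                            ∎
  where open ≡-Reasoning

-- Under an injective self-map of Fin n every point returns to itself after
-- some 1 ≤ p ≤ n steps: two of x, t x, …, tⁿ x coincide (pigeonhole), and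
-- injectivity cancels the common prefix.
period : ∀ {n} {t : Fin n → Fin n} → Injective _≡_ _≡_ t → ∀ x →
         Σ ℕ λ p → 1 ≤ p × p ≤ n × iter p t x ≡ x
period {n} {t} inj x with pigeonhole (n<1+n n) (λ a → iter (toℕ a) t x)
... | i , j , i<j , same =
  d , m<n⇒0<n∸m i<j , ≤-trans (m∸n≤m (toℕ j) (toℕ i)) (≤-pred (toℕ<n j)) ,
  sym (iter-injective (toℕ i) inj returns)
  where
  d : ℕ
  d = toℕ j ∸ toℕ i
  returns : iter (toℕ i) t x ≡ iter (toℕ i) t (iter d t x)
  returns = begin
    iter (toℕ i) t x                ≡⟨ same ⟩
    iter (toℕ j) t x                ≡⟨ cong (λ e → iter e t x) (sym (m+[n∸m]≡n (<⇒≤ i<j))) ⟩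
    iter (toℕ i + d) t x            ≡⟨ iter-+ (toℕ i) d t x ⟩
    iter (toℕ i) t (iter d t x)     ∎
    where open ≡-Reasoning

-- An injective self-map of Fin n has order dividing n!: each period p lies
-- between 1 and n, and p ∣ p! ∣ n!.
iter-factorial : ∀ {n} {t : Fin n → Fin n} → Injective _≡_ _≡_ t → ∀ x → iter (n !) t x ≡ x
iter-factorial {n} {t} inj x with period inj x
... | suc q , _ , p≤n , back with ∣-trans (m∣m*n {suc q} (q !)) (m≤n⇒m!∣n! p≤n)
...   | divides c n!≡c*p = subst (λ e → iter e t x ≡ x) (sym n!≡c*p) (iter-multiple c (suc q) t x back)

IsEndo : (A : Graph) → (Fin (size A) → Fin (size A)) → Set
IsEndo A h = ∀ x y → edge A x y ≡ true → edge A (h x) (h y) ≡ true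

IsEndo-resp : ∀ A {h h'} → (∀ x → h x ≡ h' x) → IsEndo A h → IsEndo A h'
IsEndo-resp A eq endo x y e = subst₂ (λ a b → edge A a b ≡ true) (eq x) (eq y) (endo x y e)

IsEndo-∘ : ∀ A {h h'} → IsEndo A h → IsEndo A h' → IsEndo A (h ∘ h')
IsEndo-∘ A endo endo' x y e = endo _ _ (endo' x y e)

isEndo? : ∀ A h → Dec (IsEndo A h)
isEndo? A h = all? λ x → all? λ y → (edge A x y ≟B true) →-dec (edge A (h x) (h y) ≟B true)

record Factorisation (A : Graph) (k : ℕ) : Set where
  constructor factorisation
  field
    down : Fin (size A) → Fin k
    up   : Fin k → Fin (size A)
    endo : IsEndo A (up ∘ down)

  loop : Fin k → Fin k
  loop = down ∘ up
open Factorisation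

throughGraph : ∀ {A R} → Hom A R → Hom R A → Factorisation A (size R)
throughGraph ρ σ = factorisation (fun ρ) (fun σ) (λ x y e → pres σ _ _ (pres ρ x y e))

factorisation? : ∀ A k → Dec (Factorisation A k)
factorisation? A k =
  map′ (λ (w , v , e) → factorisation w v e) (λ (factorisation w v e) → w , v , e)
       (functionSearch _ _ _
          (λ eq (v , e) → v , IsEndo-resp A (cong v ∘ eq) e)
          (λ w → functionSearch _ _ _ (λ eq → IsEndo-resp A (eq ∘ w)) (λ v → isEndo? A (v ∘ w))))

collisionOrInjective : ∀ {k m} (t : Fin k → Fin m) →
                       (Σ (Fin k) λ i → Σ (Fin k) λ i' → i ≢ i' × t i ≡ t i') ⊎ Injective _≡_ _≡_ t
collisionOrInjective t with any? (λ i → any? (λ i' → ¬? (i ≟F i') ×-dec (t i ≟F t i')))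
... | yes collision = inj₁ collision
... | no none = inj₂ injective
  where
  injective : Injective _≡_ _≡_ t
  injective {x} {y} same with x ≟F y
  ... | yes x≡y = x≡y
  ... | no x≢y  = ⊥-elim (none (x , y , x≢y , same))

-- If the loop identifies i ≢ i', then the square of the endomorphism factors
-- through one point less: the loop's values are all attained off i', so the
-- loop factors as Fin (suc n) → Fin n → Fin (suc n) by punching out i'.
compress : ∀ {A n} (F : Factorisation A (suc n)) {i i'} → i ≢ i' →
           loop F i ≡ loop F i' → Factorisation A n
compress {A} {n} F {i} {i'} i≢i' same =
  factorisation (collapse ∘ down F) (up F ∘ expand)
    (IsEndo-resp A (λ x → cong (up F) (sym (expand-collapse (down F x))))
                   (IsEndo-∘ A (endo F) (endo F)))
  where
  avoiding : ∀ j → Σ (Fin (suc n)) λ c → i' ≢ c × loop F c ≡ loop F j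
  avoiding j with j ≟F i'
  ... | yes refl = i , (λ e → i≢i' (sym e)) , same
  ... | no j≢i'  = j , (λ e → j≢i' (sym e)) , refl
  collapse : Fin (suc n) → Fin n
  collapse j = punchOut (proj₁ (proj₂ (avoiding j)))
  expand : Fin n → Fin (suc n)
  expand = loop F ∘ punchIn i'
  expand-collapse : ∀ j → expand (collapse j) ≡ loop F j
  expand-collapse j with avoiding j
  ... | c , i'≢c , loop≡ = trans (cong (loop F) (punchIn-punchOut i'≢c)) loop≡

record VertexRetraction (A : Graph) (k : ℕ) : Set where
  field
    r        : Fin (size A) → Fin k
    s        : Fin k → Fin (size A)
    r∘s      : ∀ x → r (s x) ≡ x
    s∘r-endo : IsEndo A (s ∘ r)

-- An injective loop t is inverted by t^(k! - 1); so r = t^(k! - 1) ∘ down and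
-- s = up form a retraction, s ∘ r being the endomorphism (up ∘ down)^(k!).
retractionOfInjectiveLoop : ∀ {A k} (F : Factorisation A k) → Injective _≡_ _≡_ (loop F) →
                            VertexRetraction A k
retractionOfInjectiveLoop {A} {k} F inj = record
  { r = iter e t ∘ down F ; s = up F ; r∘s = inverse ; s∘r-endo = powers e }
  where
  t : Fin k → Fin k
  t = loop F
  e : ℕ
  e = k ! ∸ 1
  inverse : ∀ x → iter e t (t x) ≡ x
  inverse x = begin
    iter e t (t x)    ≡⟨ sym (iter-+ e 1 t x) ⟩
    iter (e + 1) t x  ≡⟨ cong (λ n → iter n t x) (m∸n+n≡m (1≤n! k)) ⟩
    iter (k !) t x    ≡⟨ iter-factorial inj x ⟩
    x                 ∎
    where open ≡-Reasoning
  powers : ∀ j → IsEndo A (up F ∘ iter j t ∘ down F)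
  powers zero    = endo F
  powers (suc j) = IsEndo-∘ A (endo F) (powers j)

-- A least factorisation yields a retraction: a collision in its loop would
-- compress it to a smaller one.
minimalRetraction : ∀ {A k} (F : Factorisation A k) →
                    (∀ j → Factorisation A j → k ≤ j) → VertexRetraction A k
minimalRetraction {k = zero} F _ = retractionOfInjectiveLoop F λ { {()} }
minimalRetraction {k = suc n} F minimal with collisionOrInjective (loop F)
... | inj₂ inj                   = retractionOfInjectiveLoop F inj
... | inj₁ (i , i' , i≢i' , same) = ⊥-elim (1+n≰n (minimal n (compress F i≢i' same)))

module _ (A : Graph) where

  private
    leastFactorisation : Σ ℕ λ k → Factorisation A k × (∀ j → Factorisation A j → k ≤ j)
    leastFactorisation = leastWitness (factorisation? A) (size A) (throughGraph idH idH)

    coreSize : ℕ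
    coreSize = proj₁ leastFactorisation

    coreRetraction : VertexRetraction A coreSize
    coreRetraction = minimalRetraction (proj₁ (proj₂ leastFactorisation))
                                       (proj₂ (proj₂ leastFactorisation))
    open VertexRetraction coreRetraction

  core : Graph
  core = record { size = coreSize
                ; edge = λ x y → edge A (s x) (s y)
                ; edge-sym = λ x y → edge-sym A (s x) (s y) }

  toCore : Hom A core
  toCore = hom r s∘r-endo

  fromCore : Hom core A
  fromCore = hom s (λ x y e → e)

  toCore-fromCore : (toCore ∘H fromCore) ≈H idH
  toCore-fromCore = r∘s

  core-minimal : ∀ R → Hom A R → Hom R A → size core ≤ size R
  core-minimal R ρ σ = proj₂ (proj₂ leastFactorisation) (size R) (throughGraph ρ σ)

  core-isCore : IsCoreOf core A
  core-isCore = (toCore , fromCore , toCore-fromCore) ,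
                λ R (ρ , σ , _) → core-minimal R ρ σ

coreThroughRetract : ∀ {A B} (i : Hom A B) (p : Hom B A) → (p ∘H i) ≈H idH →
                     (toCore A ∘H (p ∘H (i ∘H fromCore A))) ≈H idH
coreThroughRetract {A} i p p∘i x = trans (cong (fun (toCore A)) (p∘i _)) (toCore-fromCore A x)

-- The core of a retract A of B is a core of B: it is a retract of B, and every
-- retract R of B comes with homomorphisms A → B → R → B → A.
coreOfRetract : ∀ {A B} (i : Hom A B) (p : Hom B A) → (p ∘H i) ≈H idH →
                IsCoreOf (core A) B
coreOfRetract {A} i p p∘i =
  (toCore A ∘H p , i ∘H fromCore A , coreThroughRetract i p p∘i) ,
  λ R (ρ , σ , _) → core-minimal A R (ρ ∘H i) (p ∘H σ)

-- A split epimorphism p (p ∘ i = id) is a weak equivalence: taking core A as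
-- the core of both sides, the induced map on cores is the identity.
splitEpi-isWeakEquivalence : ∀ {A B} (i : Hom A B) (p : Hom B A) → (p ∘H i) ≈H idH →
                             IsWeakEquivalence p
splitEpi-isWeakEquivalence {A} i p p∘i =
  core A , core A , coreOfRetract i p p∘i , core-isCore A ,
  i ∘H fromCore A , (toCore A ∘H p , onCores) ,
  toCore A , (fromCore A , toCore-fromCore A) ,
  (idH , onCores , onCores)
  where
  onCores : (toCore A ∘H (p ∘H (i ∘H fromCore A))) ≈H idH
  onCores = coreThroughRetract i p p∘i

inr : ∀ {A B} → Hom B (A ⊕ B)
inr {A} {B} = hom (size A ↑ʳ_) preserves
  where
  preserves : ∀ x y → edge B x y ≡ true → edge (A ⊕ B) (size A ↑ʳ x) (size A ↑ʳ y) ≡ true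
  preserves x y e rewrite splitAt-↑ʳ (size A) (size B) x | splitAt-↑ʳ (size A) (size B) y = e

copair-inl : ∀ {A B C} (f : Hom A C) (g : Hom B C) → (copair f g ∘H inl) ≈H f
copair-inl {A} {B} f g x = cong [ fun f , fun g ] (splitAt-↑ˡ (size A) x (size B))

copair-inr : ∀ {A B C} (f : Hom A C) (g : Hom B C) → (copair f g ∘H inr) ≈H g
copair-inr {A} {B} f g x = cong [ fun f , fun g ] (splitAt-↑ʳ (size A) (size B) x)

coproduct-ext : ∀ {A B C} (h h' : Hom (A ⊕ B) C) →
                (h ∘H inl) ≈H (h' ∘H inl) → (h ∘H inr) ≈H (h' ∘H inr) → h ≈H h'
coproduct-ext {A} {B} h h' onLeft onRight x = begin
  fun h x                ≡⟨ cong (fun h) (sym (join-splitAt (size A) (size B) x)) ⟩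
  fun h (join′ (splitAt (size A) x))  ≡⟨ onSummands (splitAt (size A) x) ⟩
  fun h' (join′ (splitAt (size A) x)) ≡⟨ cong (fun h') (join-splitAt (size A) (size B) x) ⟩
  fun h' x               ∎
  where
  open ≡-Reasoning
  join′ : Fin (size A) ⊎ Fin (size B) → Fin (size A + size B)
  join′ = join (size A) (size B)
  onSummands : ∀ u → fun h (join′ u) ≡ fun h' (join′ u)
  onSummands (inj₁ a) = onLeft a
  onSummands (inj₂ b) = onRight b

copair-inl-inr : ∀ {A B} → copair (inl {A} {B}) (inr {A} {B}) ≈H idH
copair-inl-inr {A} {B} =
  coproduct-ext {A} {B} (copair ι₁ ι₂) idH (copair-inl ι₁ ι₂) (copair-inr ι₁ ι₂)
  where
  ι₁ : Hom A (A ⊕ B)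
  ι₁ = inl
  ι₂ : Hom B (A ⊕ B)
  ι₂ = inr

emptyGraph : Graph
emptyGraph = record { size = 0 ; edge = λ () ; edge-sym = λ () }

-- An endomorphism equal to the identity is a cofibration: it is the injection
-- X → X + ∅ composed with the isomorphism X + ∅ ≅ X.
≈id-isCofibration : ∀ {X} (c : Hom X X) → c ≈H idH → IsCofibration c
≈id-isCofibration {X} c c≈id =
  emptyGraph , φ , (ι , ι∘φ , copair-inl idH fromEmpty) ,
  λ x → trans (copair-inl idH fromEmpty x) (sym (c≈id x))
  where
  fromEmpty : Hom emptyGraph X
  fromEmpty = hom (λ ()) (λ ())
  ι : Hom X (X ⊕ emptyGraph)
  ι = inl
  φ : Hom (X ⊕ emptyGraph) X
  φ = copair idH fromEmpty
  ι∘φ : (ι ∘H φ) ≈H idH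
  ι∘φ = coproduct-ext {X} {emptyGraph} (ι ∘H φ) idH (cong (fun ι) ∘ copair-inl idH fromEmpty) (λ ())

sumCylinder : (G : Graph) → Cylinder G
sumCylinder G = record
  { obj  = G ⊕ G
  ; i₀   = inl {G} {G}
  ; i₁   = inr {G} {G}
  ; p    = fold
  ; cof  = ≈id-isCofibration (copair (inl {G} {G}) inr) (copair-inl-inr {G} {G})
  ; weq  = splitEpi-isWeakEquivalence (inl {G} {G}) fold (copair-inl {G} {G} idH idH)
  ; fact = cong (fun fold) ∘ copair-inl-inr {G} {G}
  }
  where
  fold : Hom (G ⊕ G) G
  fold = copair idH idH

mainTheorem3 : (G H : Graph) (f g : Hom G H) → LeftHomotopic f g
mainTheorem3 G H f g = sumCylinder G , copair f g , copair-inl f g , copair-inr f g
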